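{- For every finite graph $G$, in the path game on $G$ player 2 has a strategy guaranteeing that the result of the game is at most $\chi_{cf}(G)$; that is, $v_p(G)\le\chi_{cf}(G)$.
   Context: For a vertex set $V'$, $G[V']$ is the induced subgraph. A path is a simple path (a single vertex counts). The path game on $G$: set $i=0$, $G^0=G$; while $V(G^i)\neq\emptyset$: increase $i$ by 1, player 1 chooses the vertex set $S^i$ of a path of $G^{i-1}$, player 2 chooses a vertex $v_i\in S^i$, and $G^i=G^{i-1}[S^i\setminus\{v_i\}]$. The result is the final value of $i$; player 1 maximizes it and player 2 minimizes it, and $v_p(G)$ is the result under optimal play by both. A conflict-free coloring with $k$ colors is a map $V(G)\to\{1,\dots,k\}$ such that on every path some color occurs exactly once; $\chi_{cf}(G)$ is the minimum such $k$ ($0$ for the empty graph). -}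

module Defs where

open import Level using (0ℓ)
open import Data.Nat using (ℕ; zero; suc; _≤_)
open import Data.Fin using (Fin)
open import Data.List using (List; []; _∷_)
open import Data.List.Membership.Propositional using (_∈_)
open import Data.List.Relation.Unary.Unique.Propositional using (Unique)
open import Data.Product using (Σ; ∃; _×_; _,_)
open import Relation.Binary.PropositionalEquality using (_≡_; _≢_)
open import Relation.Nullary using (¬_)
open import Relation.Unary using (Pred)
open import Data.Unit using (⊤)
open import Data.Empty using (⊥)

record Graph : Set₁ where
  field
    n      : ℕ
    Adj    : Fin n → Fin n → Set
    sym    : ∀ {u v} → Adj u v → Adj v u
    irrefl : ∀ {u} → ¬ Adj u u

module _ (G : Graph) where
  open Graph G

  VSet : Set₁
  VSet = Pred (Fin n) 0ℓ

  Chain : List (Fin n) → Set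
  Chain []           = ⊤
  Chain (u ∷ [])     = ⊤
  Chain (u ∷ v ∷ vs) = Adj u v × Chain (v ∷ vs)

  IsPath : List (Fin n) → Set
  IsPath []       = ⊥
  IsPath (u ∷ us) = Unique (u ∷ us) × Chain (u ∷ us)

  IsPathIn : VSet → List (Fin n) → Set
  IsPathIn H P = IsPath P × (∀ {u} → u ∈ P → H u)

  EmptySet : VSet → Set
  EmptySet H = ∀ u → ¬ H u

  remove : List (Fin n) → Fin n → VSet
  remove P v u = (u ∈ P) × (u ≢ v)

  -- P2Wins k H : in the path game started on G[H], player 2 has a strategy
  -- guaranteeing that the number of remaining rounds is at most k.
  data P2Wins : ℕ → VSet → Set₁ where
    done : ∀ {k H} → EmptySet H → P2Wins k H
    step : ∀ {k H} →
           (∀ P → IsPathIn H P → Σ (Fin n) λ v → (v ∈ P) × P2Wins k (remove P v)) →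
           P2Wins (suc k) H

  -- conflict-free colouring with k colours (colours Fin k ≅ {1..k}):
  -- on every path some colour occurs exactly once
  ConflictFree : (k : ℕ) → (Fin n → Fin k) → Set
  ConflictFree k c = ∀ P → IsPath P →
    Σ (Fin n) λ u → (u ∈ P) × (∀ {w} → w ∈ P → c w ≡ c u → w ≡ u)

  CFColourable : ℕ → Set
  CFColourable k = Σ (Fin n → Fin k) (ConflictFree k)

  IsChiCF : ℕ → Set
  IsChiCF k = CFColourable k × (∀ j → CFColourable j → k ≤ j)

  AllV : VSet
  AllV _ = ⊤

-- Player 2 always deletes a vertex whose colour is unique on the path just
-- chosen. Every remaining vertex then avoids that colour, and a colouring that
-- is conflict-free on G stays conflict-free on every induced subgraph, so the
-- game continues on a graph coloured with one colour fewer; by induction on the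
-- number of colours player 2 wins within k rounds.
module Submission where

open import Defs
open import Data.Nat using (ℕ; zero; suc; _<_; s≤s; z≤n; pred)
open import Data.Nat.Properties using (suc-injective; n≮0)
open import Data.Fin using (Fin; toℕ)
open import Data.Fin.Properties using (toℕ<n; toℕ-injective)
open import Data.Product using (Σ; _×_; _,_; proj₁)
open import Data.Empty using (⊥-elim)
open import Data.List.Membership.Propositional using (_∈_)
open import Function using (_∘_)
open import Relation.Binary.PropositionalEquality using (_≡_; _≢_; refl; cong)
open import Relation.Unary using (_⊆_)

-- Renumbers the colours above a one step down; a itself is the junk case.
squeeze : ℕ → ℕ → ℕ
squeeze zero    y       = pred y
squeeze (suc a) zero    = zero
squeeze (suc a) (suc y) = suc (squeeze a y)

squeeze-injective : ∀ {a y z} → y ≢ a → z ≢ a → squeeze a y ≡ squeeze a z → y ≡ z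
squeeze-injective {zero}  {zero}  y≢a _   _  = ⊥-elim (y≢a refl)
squeeze-injective {zero}  {suc _} {zero}  _   z≢a _  = ⊥-elim (z≢a refl)
squeeze-injective {zero}  {suc _} {suc _} _   _   eq = cong suc eq
squeeze-injective {suc _} {zero}  {zero}  _   _   _  = refl
squeeze-injective {suc _} {suc _} {suc _} y≢a z≢a eq =
  cong suc (squeeze-injective (y≢a ∘ cong suc) (z≢a ∘ cong suc) (suc-injective eq))

squeeze-< : ∀ {a m y} → a < suc m → y < suc m → y ≢ a → squeeze a y < m
squeeze-< {zero}  {_}     {zero}  _         _         y≢a = ⊥-elim (y≢a refl)
squeeze-< {zero}  {_}     {suc _} _         (s≤s y<m) _   = y<m
squeeze-< {suc _} {zero}  {_}     (s≤s ())  _         _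
squeeze-< {suc _} {suc _} {zero}  _         _         _   = s≤s z≤n
squeeze-< {suc _} {suc _} {suc _} (s≤s a<m) (s≤s y<m) y≢a =
  s≤s (squeeze-< a<m y<m (y≢a ∘ cong suc))

module _ (G : Graph) where
  open Graph G

  ConflictFreeOn : {A : Set} → VSet G → (Fin n → A) → Set
  ConflictFreeOn H c = ∀ P → IsPathIn G H P →
    Σ (Fin n) λ u → (u ∈ P) × (∀ {w} → w ∈ P → c w ≡ c u → w ≡ u)

  conflictFreeOn-⊆ : ∀ {A} {H H′ : VSet G} {c : Fin n → A} →
                     H ⊆ H′ → ConflictFreeOn H′ c → ConflictFreeOn H c
  conflictFreeOn-⊆ H⊆H′ cf P (path , P⊆H) = cf P (path , H⊆H′ ∘ P⊆H)

  conflictFreeOn-∘ : ∀ {A B} {H : VSet G} {c : Fin n → A} (f : A → B) →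
                     (∀ {v w} → H v → H w → f (c v) ≡ f (c w) → c v ≡ c w) →
                     ConflictFreeOn H c → ConflictFreeOn H (f ∘ c)
  conflictFreeOn-∘ f f-injective cf P (path , P⊆H) with cf P (path , P⊆H)
  ... | u , u∈P , unique =
    u , u∈P , λ w∈P eq → unique w∈P (f-injective (P⊆H w∈P) (P⊆H u∈P) eq)

  conflictFreeOn⇒P2Wins : ∀ m H (c : Fin n → ℕ) →
                          (∀ {v} → H v → c v < m) → ConflictFreeOn H c → P2Wins G m H
  conflictFreeOn⇒P2Wins zero    H c c<0 _  = done (λ v → n≮0 ∘ c<0)
  conflictFreeOn⇒P2Wins (suc m) H c c<m cf = step respond
    where
    respond : ∀ P → IsPathIn G H P → Σ (Fin n) λ v → (v ∈ P) × P2Wins G m (remove G P v)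
    respond P (path , P⊆H) with cf P (path , P⊆H)
    ... | u , u∈P , unique =
      u , u∈P , conflictFreeOn⇒P2Wins m (remove G P u) (squeeze (c u) ∘ c) squeezed<m
                  (conflictFreeOn-∘ (squeeze (c u)) squeeze-injectiveOn
                    (conflictFreeOn-⊆ (P⊆H ∘ proj₁) cf))
      where
      colour≢ : ∀ {w} → remove G P u w → c w ≢ c u
      colour≢ (w∈P , w≢u) eq = w≢u (unique w∈P eq)

      squeezed<m : ∀ {w} → remove G P u w → squeeze (c u) (c w) < m
      squeezed<m r@(w∈P , _) = squeeze-< (c<m (P⊆H u∈P)) (c<m (P⊆H w∈P)) (colour≢ r)

      squeeze-injectiveOn : ∀ {v w} → remove G P u v → remove G P u w →
                            squeeze (c u) (c v) ≡ squeeze (c u) (c w) → c v ≡ c w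
      squeeze-injectiveOn rv rw = squeeze-injective (colour≢ rv) (colour≢ rw)

proposition7 : (G : Graph) → (k : ℕ) → IsChiCF G k → P2Wins G k (AllV G)
proposition7 G k ((c , cf) , _) =
  conflictFreeOn⇒P2Wins G k (AllV G) (toℕ ∘ c) (λ {v} _ → toℕ<n (c v))
    (conflictFreeOn-∘ G toℕ (λ _ _ → toℕ-injective) (λ P → cf P ∘ proj₁))
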